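{- Let $(\lambda_1,\lambda_2,\lambda_3)$ be a composition of $n$ and let $d=\gcd(\lambda_1+\lambda_2,\lambda_2+\lambda_3)$. For every $x\in\llbracket 1,n\rrbracket$, the orbit of $x$ under the symmetric discrete interval exchange $T_{(\lambda_1,\lambda_2,\lambda_3)}$ is the set $$\left\{x+kd \;\middle|\; k\in\mathbb{Z},\ \frac{1-x}{d}\le k\le\frac{n-x}{d}\right\}.$$
   Context: For $\llbracket a,b\rrbracket=[a,b]\cap\mathbb{Z}$ and a composition $(\lambda_1,\lambda_2,\lambda_3)$ of $n$ (positive integers with sum $n$), $T_{(\lambda_1,\lambda_2,\lambda_3)}$ is the permutation of $\llbracket 1,n\rrbracket$ given by $T(x)=x+\lambda_2+\lambda_3$ for $x\in\llbracket 1,\lambda_1\rrbracket$, $T(x)=x+\lambda_3-\lambda_1$ for $x\in\llbracket \lambda_1+1,\lambda_1+\lambda_2\rrbracket$, and $T(x)=x-\lambda_1-\lambda_2$ for $x\in\llbracket \lambda_1+\lambda_2+1,n\rrbracket$. -}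

module Defs where

open import Data.Nat using (ℕ; zero; suc; _+_; _∸_; _≤_; _≤?_; _<_)
open import Data.Nat.GCD using (gcd)
open import Data.Integer as ℤ using (ℤ; +_)
open import Data.Product using (Σ; ∃; ∃-syntax; _×_)
open import Relation.Binary.PropositionalEquality using (_≡_)
open import Relation.Nullary using (yes; no)
open import Function using (_∘_)

record Composition3 (n : ℕ) : Set where
  field
    l₁ l₂ l₃ : ℕ
    l₁-pos : 1 ≤ l₁
    l₂-pos : 1 ≤ l₂
    l₃-pos : 1 ≤ l₃
    sum≡n  : l₁ + l₂ + l₃ ≡ n

-- Outside ⟦1,n⟧ it is the identity (irrelevant convention).
-- Subtractions are truncated but never truncate on the relevant ranges.
T : ℕ → ℕ → ℕ → ℕ → ℕ
T l₁ l₂ l₃ x with x ≤? 0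
... | yes _ = x
... | no _ with x ≤? l₁
...   | yes _ = x + l₂ + l₃
...   | no _ with x ≤? l₁ + l₂
...     | yes _ = x + l₃ ∸ l₁
...     | no _ with x ≤? l₁ + l₂ + l₃
...       | yes _ = x ∸ (l₁ + l₂)
...       | no _ = x

iterate : (ℕ → ℕ) → ℕ → ℕ → ℕ
iterate f zero    x = x
iterate f (suc m) x = f (iterate f m x)

-- Orbit of x under T: { T^m x | m ∈ ℕ } (T is a permutation of a finite set,
-- so nonnegative powers give the full orbit).
InOrbit : (ℕ → ℕ) → ℕ → ℕ → Set
InOrbit f x y = ∃[ m ] iterate f m x ≡ y

module Submission where

open import Defs

-- In 0-based coordinates u = x − 1, put a = λ₁ + λ₂, b = λ₂ + λ₃ and M = b + a.
-- Then T is the map induced on [0, n) by the rotation u ↦ u + b (mod M):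
-- a point either rotates straight back into [0, n), or into the gap [n, M) of
-- length λ₂, which the next rotation step leaves again.  Hence the T-orbit of x
-- is the trace on [0, n) of its rotation orbit, which by Bézout is the residue
-- class of x modulo gcd(b, M) = gcd(a, b).

module Orbits where
  open import Data.Nat
  open import Data.Nat.Properties
  open import Data.Nat.DivMod
  import Data.Nat.Divisibility as ℕ
  open import Data.Nat.GCD using (GCD; gcd; gcd-GCD; module GCD; module Bézout)
  open import Data.Nat.Tactic.RingSolver using (solve-∀)
  open import Data.Integer as ℤ using (ℤ; +_)
  import Data.Integer.Properties as ℤₚ
  open import Data.Integer.Divisibility.Signed as ℤ∣ using (_∣_; divides)
  import Data.Integer.Tactic.RingSolver as ℤ-Solver
  open import Data.Empty using (⊥-elim)
  open import Data.Product using (_,_; _×_; ∃-syntax)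
  open import Function.Bundles using (_⇔_; mk⇔; Equivalence)
  open import Relation.Binary.PropositionalEquality
  open import Relation.Nullary using (yes; no)
  open ≡-Reasoning

  module _ (l₁ l₂ l₃ : ℕ) where

    T-on-first : ∀ {u} → u < l₁ → T l₁ l₂ l₃ (suc u) ≡ suc (u + (l₂ + l₃))
    T-on-first {u} u<l₁ with suc u ≤? 0
    ... | yes ()
    ... | no _ with suc u ≤? l₁
    ...   | yes _ = cong suc (+-assoc u l₂ l₃)
    ...   | no u≮l₁ = ⊥-elim (u≮l₁ u<l₁)

    T-on-second : ∀ {r} → r < l₂ → T l₁ l₂ l₃ (suc (l₁ + r)) ≡ suc (r + l₃)
    T-on-second {r} r<l₂ with suc (l₁ + r) ≤? 0
    ... | yes ()
    ... | no _ with suc (l₁ + r) ≤? l₁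
    ...   | yes x≤l₁ = ⊥-elim (<⇒≱ (s≤s (m≤m+n l₁ r)) x≤l₁)
    ...   | no _ with suc (l₁ + r) ≤? l₁ + l₂
    ...     | no x≰l₁+l₂ = ⊥-elim (x≰l₁+l₂ (+-monoʳ-< l₁ r<l₂))
    ...     | yes _ = begin
      suc (l₁ + r + l₃) ∸ l₁   ≡⟨ cong (λ z → suc z ∸ l₁) (+-assoc l₁ r l₃) ⟩
      suc (l₁ + (r + l₃)) ∸ l₁ ≡⟨ cong (_∸ l₁) (sym (+-suc l₁ (r + l₃))) ⟩
      l₁ + suc (r + l₃) ∸ l₁   ≡⟨ m+n∸m≡n l₁ (suc (r + l₃)) ⟩
      suc (r + l₃)             ∎

    T-on-third : ∀ {r} → r < l₃ → T l₁ l₂ l₃ (suc (l₁ + l₂ + r)) ≡ suc r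
    T-on-third {r} r<l₃ with suc (l₁ + l₂ + r) ≤? 0
    ... | yes ()
    ... | no _ with suc (l₁ + l₂ + r) ≤? l₁
    ...   | yes x≤l₁ =
      ⊥-elim (<⇒≱ (s≤s (≤-trans (m≤m+n l₁ l₂) (m≤m+n (l₁ + l₂) r))) x≤l₁)
    ...   | no _ with suc (l₁ + l₂ + r) ≤? l₁ + l₂
    ...     | yes x≤a = ⊥-elim (<⇒≱ (s≤s (m≤m+n (l₁ + l₂) r)) x≤a)
    ...     | no _ with suc (l₁ + l₂ + r) ≤? l₁ + l₂ + l₃
    ...       | no x≰n = ⊥-elim (x≰n (+-monoʳ-< (l₁ + l₂) r<l₃))
    ...       | yes _ = begin
      suc (l₁ + l₂ + r) ∸ (l₁ + l₂) ≡⟨ cong (_∸ (l₁ + l₂)) (sym (+-suc (l₁ + l₂) r)) ⟩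
      l₁ + l₂ + suc r ∸ (l₁ + l₂)   ≡⟨ m+n∸m≡n (l₁ + l₂) (suc r) ⟩
      suc r                         ∎

  iterate-suc : ∀ (f : ℕ → ℕ) m x → iterate f (suc m) x ≡ iterate f m (f x)
  iterate-suc f zero    x = refl
  iterate-suc f (suc m) x = cong f (iterate-suc f m x)

  InOrbit-step : ∀ {g : ℕ → ℕ} {x y z} → g x ≡ y → InOrbit g y z → InOrbit g x z
  InOrbit-step {g} {x} gx≡y (m , gᵐy≡z) =
    suc m , trans (iterate-suc g m x) (trans (cong (iterate g m) gx≡y) gᵐy≡z)

  -- g acts on the 1-based points of ⟦1, n⟧ and f on the 0-based points of [0, n):
  -- g is the first return of f to [0, n), taking at most one step outside it.
  data FirstReturn (f g : ℕ → ℕ) (n u : ℕ) : Set where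
    direct  : f u < n → g (suc u) ≡ suc (f u) → FirstReturn f g n u
    via-gap : n ≤ f u → f (f u) < n → g (suc u) ≡ suc (f (f u)) → FirstReturn f g n u

  module _ {f g : ℕ → ℕ} {n : ℕ} (first-return : ∀ {u} → u < n → FirstReturn f g n u) where

    induced-orbit⇒ : ∀ m {u} → u < n →
                     ∃[ j ] iterate f j u < n × iterate g m (suc u) ≡ suc (iterate f j u)
    induced-orbit⇒ zero    u<n = 0 , u<n , refl
    induced-orbit⇒ (suc m) u<n with induced-orbit⇒ m u<n
    ... | j , fʲu<n , gᵐ≡ with first-return fʲu<n
    ...   | direct fʲ⁺¹u<n g≡    = suc j , fʲ⁺¹u<n , trans (cong g gᵐ≡) g≡
    ...   | via-gap _ fʲ⁺²u<n g≡    = suc (suc j) , fʲ⁺²u<n , trans (cong g gᵐ≡) g≡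

    induced-orbit⇐ : ∀ j {u v} → u < n → v < n → iterate f j u ≡ v → InOrbit g (suc u) (suc v)
    induced-orbit⇐ zero _ _ u≡v = 0 , cong suc u≡v
    induced-orbit⇐ (suc j) {u} u<n v<n fʲ⁺¹u≡v with first-return u<n
    ... | direct fu<n g≡ =
      InOrbit-step g≡ (induced-orbit⇐ j fu<n v<n (trans (sym (iterate-suc f j u)) fʲ⁺¹u≡v))
    induced-orbit⇐ (suc zero) u<n v<n fu≡v | via-gap n≤fu _ _ =
      ⊥-elim (<⇒≱ v<n (subst (n ≤_) fu≡v n≤fu))
    induced-orbit⇐ (suc (suc j)) {u} u<n v<n fʲ⁺²u≡v | via-gap _ ffu<n g≡ =
      InOrbit-step g≡ (induced-orbit⇐ j ffu<n v<n
        (trans (sym (trans (iterate-suc f (suc j) u) (iterate-suc f j (f u)))) fʲ⁺²u≡v))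

  %-cong-+ : ∀ {m m′ n n′ o} .{{_ : NonZero o}} →
             m % o ≡ m′ % o → n % o ≡ n′ % o → (m + n) % o ≡ (m′ + n′) % o
  %-cong-+ {m} {m′} {n} {n′} {o} m≡m′ n≡n′ = begin
    (m + n) % o               ≡⟨ %-distribˡ-+ m n o ⟩
    (m % o + n % o) % o       ≡⟨ cong₂ (λ x y → (x + y) % o) m≡m′ n≡n′ ⟩
    (m′ % o + n′ % o) % o     ≡⟨ sym (%-distribˡ-+ m′ n′ o) ⟩
    (m′ + n′) % o             ∎

  GCD-∣⇒j*m%n≡o%n : ∀ {m n d o} .{{_ : NonZero n}} →
                    GCD m n d → d ℕ.∣ o → ∃[ j ] j * m % n ≡ o % n
  GCD-∣⇒j*m%n≡o%n {n = zero} {{()}}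
  GCD-∣⇒j*m%n≡o%n {m} {suc n′} {d} g (ℕ.divides t refl) with Bézout.identity g
  ... | Bézout.+- x y d+yn≡xm = t * x , (begin
    t * x * m % n                 ≡⟨ cong (_% n) (trans (*-assoc t x m) (cong (t *_) (sym d+yn≡xm))) ⟩
    t * (d + y * n) % n           ≡⟨ cong (_% n) (distrib t d y n) ⟩
    (t * d + t * y * n) % n       ≡⟨ [m+kn]%n≡m%n (t * d) (t * y) n ⟩
    t * d % n                     ∎)
    where
    n : ℕ
    n = suc n′
    distrib : ∀ t d y n → t * (d + y * n) ≡ t * d + t * y * n
    distrib = solve-∀
  -- Here x m ≡ −d modulo n, so x (n − 1) m ≡ d.
  ... | Bézout.-+ x y d+xm≡yn = t * x * n′ , (begin
    t * x * n′ * m % n                 ≡⟨ sym ([m+kn]%n≡m%n (t * x * n′ * m) (t * d) n) ⟩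
    (t * x * n′ * m + t * d * n) % n   ≡⟨ cong (_% n) (regroup t x n′ m d) ⟩
    (t * d + n′ * t * (d + x * m)) % n ≡⟨ cong (λ z → (t * d + n′ * t * z) % n) d+xm≡yn ⟩
    (t * d + n′ * t * (y * n)) % n     ≡⟨ cong (_% n) (reassoc t d n′ y n) ⟩
    (t * d + n′ * t * y * n) % n       ≡⟨ [m+kn]%n≡m%n (t * d) (n′ * t * y) n ⟩
    t * d % n                          ∎)
    where
    n : ℕ
    n = suc n′
    regroup : ∀ t x n′ m d → t * x * n′ * m + t * d * suc n′ ≡ t * d + n′ * t * (d + x * m)
    regroup = solve-∀
    reassoc : ∀ t d n′ y n → t * d + n′ * t * (y * n) ≡ t * d + n′ * t * y * n
    reassoc = solve-∀

  m+n≡o+p⇒o-m≡n-p : ∀ m n o p → m + n ≡ o + p → + o ℤ.- + m ≡ + n ℤ.- + p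
  m+n≡o+p⇒o-m≡n-p m n o p m+n≡o+p = begin
    + o ℤ.- + m                     ≡⟨ add-sub (+ o) (+ m) (+ p) ⟩
    + o ℤ.+ + p ℤ.- + m ℤ.- + p     ≡⟨ cong (λ z → z ℤ.- + m ℤ.- + p) o+p≡m+n ⟩
    + m ℤ.+ + n ℤ.- + m ℤ.- + p     ≡⟨ cancel (+ m) (+ n) (+ p) ⟩
    + n ℤ.- + p                     ∎
    where
    o+p≡m+n : + o ℤ.+ + p ≡ + m ℤ.+ + n
    o+p≡m+n = trans (sym (ℤₚ.pos-+ o p)) (trans (cong +_ (sym m+n≡o+p)) (ℤₚ.pos-+ m n))
    add-sub : ∀ o m p → o ℤ.- m ≡ o ℤ.+ p ℤ.- m ℤ.- p
    add-sub = ℤ-Solver.solve-∀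
    cancel : ∀ m n p → m ℤ.+ n ℤ.- m ℤ.- p ≡ n ℤ.- p
    cancel = ℤ-Solver.solve-∀

  [1+m]-[1+n]≡m-n : ∀ m n → + suc m ℤ.- + suc n ≡ + m ℤ.- + n
  [1+m]-[1+n]≡m-n m n = trans (ℤₚ.[1+m]⊖[1+n]≡m⊖n m n) (sym (ℤₚ.m-n≡m⊖n m n))

  i≡j+k⇔i-j≡k : ∀ (i j k : ℤ) → (i ≡ j ℤ.+ k) ⇔ (i ℤ.- j ≡ k)
  i≡j+k⇔i-j≡k i j k = mk⇔ (λ i≡j+k → trans (cong (ℤ._- j) i≡j+k) (add-sub j k))
                          (λ i-j≡k → trans (sub-add i j) (cong (ℤ._+_ j) i-j≡k))
    where
    add-sub : ∀ j k → j ℤ.+ k ℤ.- j ≡ k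
    add-sub = ℤ-Solver.solve-∀
    sub-add : ∀ i j → i ≡ j ℤ.+ (i ℤ.- j)
    sub-add = ℤ-Solver.solve-∀

  i≤j⇔i-k≤j-k : ∀ (i j k : ℤ) → (i ℤ.≤ j) ⇔ (i ℤ.- k ℤ.≤ j ℤ.- k)
  i≤j⇔i-k≤j-k i j k = mk⇔ (ℤₚ.+-monoˡ-≤ (ℤ.- k))
    (λ i-k≤j-k → subst₂ ℤ._≤_ (sub-add i k) (sub-add j k) (ℤₚ.+-monoˡ-≤ k i-k≤j-k))
    where
    sub-add : ∀ i k → i ℤ.- k ℤ.+ k ≡ i
    sub-add = ℤ-Solver.solve-∀

  offset-bounds⇔range-congruence : ∀ {x y n : ℕ} {d : ℤ} →
    (∃[ k ] (+ 1 ℤ.- + x ℤ.≤ k ℤ.* d) × (k ℤ.* d ℤ.≤ + n ℤ.- + x) × (+ y ≡ + x ℤ.+ k ℤ.* d))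
      ⇔ (1 ≤ y × y ≤ n × d ∣ + y ℤ.- + x)
  offset-bounds⇔range-congruence {x} {y} {n} {d} = mk⇔ to from
    where
    Offset RangeCongruence : Set
    Offset = ∃[ k ] (+ 1 ℤ.- + x ℤ.≤ k ℤ.* d) × (k ℤ.* d ℤ.≤ + n ℤ.- + x) × (+ y ≡ + x ℤ.+ k ℤ.* d)
    RangeCongruence = 1 ≤ y × y ≤ n × d ∣ + y ℤ.- + x

    lower : (+ 1 ℤ.≤ + y) ⇔ (+ 1 ℤ.- + x ℤ.≤ + y ℤ.- + x)
    lower = i≤j⇔i-k≤j-k (+ 1) (+ y) (+ x)
    upper : (+ y ℤ.≤ + n) ⇔ (+ y ℤ.- + x ℤ.≤ + n ℤ.- + x)
    upper = i≤j⇔i-k≤j-k (+ y) (+ n) (+ x)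
    offset : ∀ k → (+ y ≡ + x ℤ.+ k ℤ.* d) ⇔ (+ y ℤ.- + x ≡ k ℤ.* d)
    offset k = i≡j+k⇔i-j≡k (+ y) (+ x) (k ℤ.* d)

    to : Offset → RangeCongruence
    to (k , 1-x≤kd , kd≤n-x , y≡x+kd) =
      ℤₚ.drop‿+≤+ (Equivalence.from lower (subst (+ 1 ℤ.- + x ℤ.≤_) (sym y-x≡kd) 1-x≤kd)) ,
      ℤₚ.drop‿+≤+ (Equivalence.from upper (subst (ℤ._≤ + n ℤ.- + x) (sym y-x≡kd) kd≤n-x)) ,
      divides k y-x≡kd
      where
      y-x≡kd : + y ℤ.- + x ≡ k ℤ.* d
      y-x≡kd = Equivalence.to (offset k) y≡x+kd

    from : RangeCongruence → Offset
    from (1≤y , y≤n , divides k y-x≡kd) =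
      k , subst (+ 1 ℤ.- + x ℤ.≤_) y-x≡kd (Equivalence.to lower (ℤ.+≤+ 1≤y)) ,
          subst (ℤ._≤ + n ℤ.- + x) y-x≡kd (Equivalence.to upper (ℤ.+≤+ y≤n)) ,
          Equivalence.from (offset k) y-x≡kd

  module Rotation (M b : ℕ) .{{_ : NonZero M}} where

    rotate : ℕ → ℕ
    rotate u = (u + b) % M

    iterate-rotate : ∀ j {u} → u < M → iterate rotate j u ≡ (u + j * b) % M
    iterate-rotate zero    {u} u<M = sym (trans (cong (_% M) (+-identityʳ u)) (m<n⇒m%n≡m u<M))
    iterate-rotate (suc j) {u} u<M = begin
      (iterate rotate j u + b) % M  ≡⟨ cong (λ z → (z + b) % M) (iterate-rotate j u<M) ⟩
      ((u + j * b) % M + b) % M     ≡⟨ %-cong-+ (m%n%n≡m%n (u + j * b) M) refl ⟩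
      (u + j * b + b) % M           ≡⟨ cong (_% M) (+-assoc u (j * b) b) ⟩
      (u + (j * b + b)) % M         ≡⟨ cong (λ z → (u + z) % M) (+-comm (j * b) b) ⟩
      (u + suc j * b) % M           ∎

    rotation-orbit : ∀ {d u v} → GCD b M d → u < M → v < M →
                     (∃[ j ] iterate rotate j u ≡ v) ⇔ (+ d ∣ + v ℤ.- + u)
    rotation-orbit {d} {u} {v} g u<M v<M = mk⇔ reached⇒∣ ∣⇒reached
      where
      +d∣+b : + d ∣ + b
      +d∣+b = ℤ∣.∣ᵤ⇒∣ (GCD.gcd∣m g)
      +d∣+M : + d ∣ + M
      +d∣+M = ℤ∣.∣ᵤ⇒∣ (GCD.gcd∣n g)

      reached⇒∣ : ∃[ j ] iterate rotate j u ≡ v → + d ∣ + v ℤ.- + u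
      reached⇒∣ (j , rʲu≡v) = subst (+ d ∣_) (sym v-u≡jb-qM) (ℤ∣.∣m∣n⇒∣m-n d∣jb d∣qM)
        where
        q : ℕ
        q = (u + j * b) / M
        v-u≡jb-qM : + v ℤ.- + u ≡ + (j * b) ℤ.- + (q * M)
        v-u≡jb-qM = m+n≡o+p⇒o-m≡n-p u (j * b) v (q * M) (trans (m≡m%n+[m/n]*n (u + j * b) M)
                      (cong (_+ q * M) (trans (sym (iterate-rotate j u<M)) rʲu≡v)))
        d∣jb : + d ∣ + (j * b)
        d∣jb = subst (+ d ∣_) (sym (ℤₚ.pos-* j b)) (ℤ∣.∣n⇒∣m*n (+ j) +d∣+b)
        d∣qM : + d ∣ + (q * M)
        d∣qM = subst (+ d ∣_) (sym (ℤₚ.pos-* q M)) (ℤ∣.∣n⇒∣m*n (+ q) +d∣+M)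

      ∣⇒reached : + d ∣ + v ℤ.- + u → ∃[ j ] iterate rotate j u ≡ v
      ∣⇒reached d∣v-u = let j , jb≡N = GCD-∣⇒j*m%n≡o%n g d∣N in j , (begin
        iterate rotate j u  ≡⟨ iterate-rotate j u<M ⟩
        (u + j * b) % M     ≡⟨ %-cong-+ refl jb≡N ⟩
        (u + N) % M         ≡⟨ cong (_% M) u+N≡v+M ⟩
        (v + M) % M         ≡⟨ [m+n]%n≡m%n v M ⟩
        v % M               ≡⟨ m<n⇒m%n≡m v<M ⟩
        v                   ∎)
        where
        N : ℕ
        N = v + M ∸ u
        u+N≡v+M : u + N ≡ v + M
        u+N≡v+M = m+[n∸m]≡n (≤-trans (<⇒≤ u<M) (m≤n+m M v))
        d∣N-M : + d ∣ + N ℤ.- + M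
        d∣N-M = subst (+ d ∣_) (m+n≡o+p⇒o-m≡n-p u N v M u+N≡v+M) d∣v-u
        d∣N : d ℕ.∣ N
        d∣N = ℤ∣.∣⇒∣ᵤ (ℤ∣.∣m+n∣n⇒∣m {m = + N} d∣N-M (ℤ∣.∣m⇒∣-m +d∣+M))

  module Exchange (l₁ l₂ l₃ : ℕ) (l₂-pos : 1 ≤ l₂) where

    a b n M d : ℕ
    a = l₁ + l₂
    b = l₂ + l₃
    n = l₁ + l₂ + l₃
    M = b + a
    d = gcd a b

    instance
      M-nonZero : NonZero M
      M-nonZero = >-nonZero (≤-trans l₂-pos (≤-trans (m≤m+n l₂ l₃) (m≤m+n b a)))

    open Rotation M b

    exchange : ℕ → ℕ
    exchange = T l₁ l₂ l₃

    n≡l₁+b : n ≡ l₁ + b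
    n≡l₁+b = +-assoc l₁ l₂ l₃

    n≤M : n ≤ M
    n≤M = subst (_≤ M) (sym (trans n≡l₁+b (+-comm l₁ b))) (+-monoʳ-≤ b (m≤m+n l₁ l₂))

    first-interval : ∀ {u} → u < l₁ → FirstReturn rotate exchange n u
    first-interval {u} u<l₁ =
      direct (subst (_< n) (sym ru≡u+b) u+b<n)
             (trans (T-on-first l₁ l₂ l₃ u<l₁) (cong suc (sym ru≡u+b)))
      where
      u+b<n : u + b < n
      u+b<n = subst (u + b <_) (sym n≡l₁+b) (+-monoˡ-< b u<l₁)
      ru≡u+b : rotate u ≡ u + b
      ru≡u+b = m<n⇒m%n≡m (<-≤-trans u+b<n n≤M)

    second-interval : ∀ {r} → r < l₂ → FirstReturn rotate exchange n (l₁ + r)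
    second-interval {r} r<l₂ =
      via-gap (subst (n ≤_) (sym ru≡u+b) n≤u+b) (subst (_< n) (sym rru≡r+l₃) r+l₃<n)
              (trans (T-on-second l₁ l₂ l₃ r<l₂) (cong suc (sym rru≡r+l₃)))
      where
      u+b<M : l₁ + r + b < M
      u+b<M = subst (l₁ + r + b <_) (+-comm a b) (+-monoˡ-< b (+-monoʳ-< l₁ r<l₂))
      ru≡u+b : rotate (l₁ + r) ≡ l₁ + r + b
      ru≡u+b = m<n⇒m%n≡m u+b<M
      n≤u+b : n ≤ l₁ + r + b
      n≤u+b = subst (_≤ l₁ + r + b) (sym n≡l₁+b) (+-monoˡ-≤ b (m≤m+n l₁ r))
      r+l₃<n : r + l₃ < n
      r+l₃<n = <-≤-trans (+-monoˡ-< l₃ r<l₂) (subst (b ≤_) (sym n≡l₁+b) (m≤n+m b l₁))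
      wrap : ∀ l₁ l₂ l₃ r → l₁ + r + (l₂ + l₃) + (l₂ + l₃) ≡ r + l₃ + (l₂ + l₃ + (l₁ + l₂))
      wrap = solve-∀
      rru≡r+l₃ : rotate (rotate (l₁ + r)) ≡ r + l₃
      rru≡r+l₃ = begin
        rotate (rotate (l₁ + r))  ≡⟨ cong rotate ru≡u+b ⟩
        (l₁ + r + b + b) % M      ≡⟨ cong (_% M) (wrap l₁ l₂ l₃ r) ⟩
        (r + l₃ + M) % M          ≡⟨ [m+n]%n≡m%n (r + l₃) M ⟩
        (r + l₃) % M              ≡⟨ m<n⇒m%n≡m (<-≤-trans r+l₃<n n≤M) ⟩
        r + l₃                    ∎

    third-interval : ∀ {r} → r < l₃ → FirstReturn rotate exchange n (a + r)
    third-interval {r} r<l₃ =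
      direct (subst (_< n) (sym ru≡r) r<n)
             (trans (T-on-third l₁ l₂ l₃ r<l₃) (cong suc (sym ru≡r)))
      where
      r<n : r < n
      r<n = <-≤-trans r<l₃ (m≤n+m l₃ a)
      wrap : ∀ a r b → a + r + b ≡ r + (b + a)
      wrap = solve-∀
      ru≡r : rotate (a + r) ≡ r
      ru≡r = begin
        (a + r + b) % M  ≡⟨ cong (_% M) (wrap a r b) ⟩
        (r + M) % M      ≡⟨ [m+n]%n≡m%n r M ⟩
        r % M            ≡⟨ m<n⇒m%n≡m (<-≤-trans r<n n≤M) ⟩
        r                ∎

    T-first-return : ∀ {u} → u < n → FirstReturn rotate exchange n u
    T-first-return {u} u<n with u <? l₁
    ... | yes u<l₁ = first-interval u<l₁
    ... | no u≮l₁ with m≤n⇒∃[o]m+o≡n (≮⇒≥ u≮l₁)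
    ...   | r , refl with r <? l₂
    ...     | yes r<l₂ = second-interval r<l₂
    ...     | no r≮l₂ with m≤n⇒∃[o]m+o≡n (≮⇒≥ r≮l₂)
    ...       | s , refl =
      subst (FirstReturn rotate exchange n) (+-assoc l₁ l₂ s) (third-interval s<l₃)
      where
      s<l₃ : s < l₃
      s<l₃ = +-cancelˡ-< a s l₃ (subst (_< n) (sym (+-assoc l₁ l₂ s)) u<n)

    T-orbit : ∀ {x y} → 1 ≤ x → x ≤ n →
              InOrbit exchange x y ⇔ (1 ≤ y × y ≤ n × + d ∣ + y ℤ.- + x)
    T-orbit {suc u} _ u<n = mk⇔ orbit⇒congruent congruent⇒orbit
      where
      Congruent : ℕ → Set
      Congruent y = 1 ≤ y × y ≤ n × + d ∣ + y ℤ.- + suc u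

      orbit-in-residues : ∀ {v} → v < n →
                          (∃[ j ] iterate rotate j u ≡ v) ⇔ (+ d ∣ + suc v ℤ.- + suc u)
      orbit-in-residues {v} v<n =
        subst (λ i → (∃[ j ] iterate rotate j u ≡ v) ⇔ (+ d ∣ i)) (sym ([1+m]-[1+n]≡m-n v u))
          (rotation-orbit (GCD.step (GCD.sym (gcd-GCD a b))) (<-≤-trans u<n n≤M) (<-≤-trans v<n n≤M))

      orbit⇒congruent : ∀ {y} → InOrbit exchange (suc u) y → Congruent y
      orbit⇒congruent (m , Tᵐx≡y) with induced-orbit⇒ T-first-return m u<n
      ... | j , rʲu<n , Tᵐx≡ rewrite sym Tᵐx≡y | Tᵐx≡ =
        s≤s z≤n , rʲu<n , Equivalence.to (orbit-in-residues rʲu<n) (j , refl)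

      congruent⇒orbit : ∀ {y} → Congruent y → InOrbit exchange (suc u) y
      congruent⇒orbit {suc v} (_ , v<n , d∣y-x) =
        let j , rʲu≡v = Equivalence.from (orbit-in-residues v<n) d∣y-x
        in induced-orbit⇐ T-first-return j u<n v<n rʲu≡v

open import Data.Nat using (ℕ; _+_; _≤_)
open import Data.Nat.GCD using (gcd)
open import Data.Integer as ℤ using (ℤ; +_; _-_; _*_)
open import Data.Product using (∃-syntax; _×_)
open import Relation.Binary.PropositionalEquality using (_≡_; refl)
open import Function.Bundles using (_⇔_)
open import Function.Construct.Composition using (_⇔-∘_)
open import Function.Construct.Symmetry using (⇔-sym)
open Orbits using (module Exchange; offset-bounds⇔range-congruence)

theorem14 : (n : ℕ) (c : Composition3 n) (x : ℕ) → 1 ≤ x → x ≤ n →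
    (y : ℕ) →
    InOrbit (T (Composition3.l₁ c) (Composition3.l₂ c) (Composition3.l₃ c)) x y
      ⇔ (∃[ k ] ((+ 1 - + x ℤ.≤ k * + gcd (Composition3.l₁ c + Composition3.l₂ c) (Composition3.l₂ c + Composition3.l₃ c))
                 × (k * + gcd (Composition3.l₁ c + Composition3.l₂ c) (Composition3.l₂ c + Composition3.l₃ c) ℤ.≤ + n - + x)
                 × (+ y ≡ + x ℤ.+ k * + gcd (Composition3.l₁ c + Composition3.l₂ c) (Composition3.l₂ c + Composition3.l₃ c))))
theorem14 .(l₁ + l₂ + l₃) record { l₁ = l₁ ; l₂ = l₂ ; l₃ = l₃ ; l₂-pos = l₂-pos ; sum≡n = refl } x 1≤x x≤n y =
  ⇔-sym offset-bounds⇔range-congruence ⇔-∘ Exchange.T-orbit l₁ l₂ l₃ l₂-pos 1≤x x≤n
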